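{- Let $\sigma\in\mathbf{M}(n,2)$ and $t\in T$ such that $\{\sigma^i(t)\mid 0\le i\le n-1\}$ is a basis of $T$. In $X=T\rtimes\langle\sigma\rangle$ set $r=\sigma$ and $\ell=t$. Write $\alpha=o(\sigma)=k2^m$ with $k$ odd, and let $f(x)$ be the minimal polynomial of $\sigma$. Then $$o(r\ell)=\begin{cases}\alpha, & (x-1)^{2^m}\nmid f(x);\\ 2\alpha, & (x-1)^{2^m}\,\|\, f(x).\end{cases}$$
   Context: $T$ is the translation subgroup of $\mathrm{AGL}(n,2)=T\rtimes\mathrm{GL}(n,2)$, identified with $V(n,2)=\mathbb{F}_2^n$, and $\sigma\in\mathrm{GL}(n,2)$ acts by $\sigma^{ -1}t\sigma=\sigma(t)$. $\mathbf{M}(n,2)$ is a set of representatives of the $\mathrm{GL}(n,2)$-conjugacy classes of $\sigma\in\mathrm{GL}(n,2)$ whose minimal polynomial has degree $n$. $g^a\,\|\,h$ means $g^a\mid h$ but $g^{a+1}\nmid h$. -}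

module Defs where

open import Data.Bool using (Bool; true; false; _∧_; _xor_; if_then_else_)
open import Data.Nat using (ℕ; zero; suc; _<_; _≤_; _*_; _+_; _^_)
open import Data.Nat.Divisibility using (_∣_)
open import Data.Fin using (Fin; toℕ; _≟_)
open import Data.Vec using (Vec; []; _∷_; tabulate; lookup; map; zipWith; foldr; replicate)
open import Data.List using (List; []; _∷_; length; last)
open import Data.Maybe using (just)
open import Data.Product using (_×_; ∃; _,_)
open import Relation.Nullary using (¬_; does)
open import Relation.Binary.PropositionalEquality using (_≡_; _≢_)

-- Linear algebra over F₂ = Bool (xor is +, ∧ is ·)

Vec₂ : ℕ → Set
Vec₂ n = Vec Bool n

-- n×n matrices over F₂, as a vector of rows
Mat : ℕ → Set
Mat n = Vec (Vec Bool n) n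

bsum : ∀ {n} → Vec Bool n → Bool
bsum = foldr _ _xor_ false

vzero : ∀ {n} → Vec₂ n
vzero = replicate _ false

vadd : ∀ {n} → Vec₂ n → Vec₂ n → Vec₂ n
vadd = zipWith _xor_

mzero : ∀ {n} → Mat n
mzero = replicate _ (replicate _ false)

mid : ∀ {n} → Mat n
mid = tabulate λ i → tabulate λ j → does (i ≟ j)

madd : ∀ {n} → Mat n → Mat n → Mat n
madd = zipWith vadd

mmul : ∀ {n} → Mat n → Mat n → Mat n
mmul A B = tabulate λ i → tabulate λ j →
  bsum (tabulate λ k → lookup (lookup A i) k ∧ lookup (lookup B k) j)

mvec : ∀ {n} → Mat n → Vec₂ n → Vec₂ n
mvec A v = map (λ row → bsum (zipWith _∧_ row v)) A

mpow : ∀ {n} → Mat n → ℕ → Mat n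
mpow A zero = mid
mpow A (suc j) = mmul (mpow A j) A

IsInvertible : ∀ {n} → Mat n → Set
IsInvertible {n} A = ∃ λ (B : Mat n) → mmul A B ≡ mid × mmul B A ≡ mid

lincomb : ∀ {n m} → Vec Bool m → (Fin m → Vec₂ n) → Vec₂ n
lincomb {n} {m} c b = foldr _ vadd vzero (tabulate λ i → if lookup c i then b i else vzero)

IsBasis : ∀ {n} → (Fin n → Vec₂ n) → Set
IsBasis {n} b =
  (∀ (c : Vec Bool n) → lincomb c b ≡ vzero → c ≡ replicate _ false)
  × (∀ (v : Vec₂ n) → ∃ λ (c : Vec Bool n) → lincomb c b ≡ v)

-- Polynomials over F₂: coefficient lists, lowest degree first

Poly : Set
Poly = List Bool

coeff : Poly → ℕ → Bool
coeff [] _ = false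
coeff (a ∷ p) zero = a
coeff (a ∷ p) (suc i) = coeff p i

-- equality of polynomials (coefficientwise, ignoring trailing zeros)
_≈ₚ_ : Poly → Poly → Set
p ≈ₚ q = ∀ i → coeff p i ≡ coeff q i

padd : Poly → Poly → Poly
padd [] q = q
padd (a ∷ p) [] = a ∷ p
padd (a ∷ p) (b ∷ q) = (a xor b) ∷ padd p q

pscale : Bool → Poly → Poly
pscale a [] = []
pscale a (b ∷ q) = (a ∧ b) ∷ pscale a q

pmul : Poly → Poly → Poly
pmul [] q = []
pmul (a ∷ p) q = padd (pscale a q) (false ∷ pmul p q)

pone : Poly
pone = true ∷ []

ppow : Poly → ℕ → Poly
ppow p zero = pone
ppow p (suc j) = pmul (ppow p j) p

-- the polynomial x - 1 = x + 1 over F₂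
xMinus1 : Poly
xMinus1 = true ∷ true ∷ []

_∣ₚ_ : Poly → Poly → Set
g ∣ₚ h = ∃ λ q → pmul q g ≈ₚ h

_^_∥ₚ_ : Poly → ℕ → Poly → Set
g ^ a ∥ₚ h = (ppow g a ∣ₚ h) × ¬ (ppow g (suc a) ∣ₚ h)

-- monic: the (nonempty) list ends in a 1; degree = length ∸ 1
Monic : Poly → Set
Monic p = last p ≡ just true

peval : ∀ {n} → Mat n → Poly → Mat n
peval A [] = mzero
peval A (a ∷ p) = madd (if a then mid else mzero) (mmul A (peval A p))

IsMinPoly : ∀ {n} → Mat n → Poly → Set
IsMinPoly A f = Monic f × peval A f ≡ mzero
  × (∀ g → Monic g → peval A g ≡ mzero → length f ≤ length g)

HasOrder : {A : Set} → A → (ℕ → A) → ℕ → Set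
HasOrder e pow d = 0 < d × pow d ≡ e × (∀ j → 0 < j → j < d → pow j ≢ e)

-- AGL(n,2) = T ⋊ GL(n,2).  The pair (M , v) denotes the product M·v
-- (M ∈ GL(n,2), v ∈ T).  With σ⁻¹ t σ = σ(t), i.e. t σ = σ σ(t):
-- (M v)(N w) = M N (N⁻¹ v N) w = (M N) (N(v) + w).

AGL : ℕ → Set
AGL n = Mat n × Vec₂ n

amul : ∀ {n} → AGL n → AGL n → AGL n
amul (M , v) (N , w) = mmul M N , vadd (mvec N v) w

aone : ∀ {n} → AGL n
aone = mid , vzero

apow : ∀ {n} → AGL n → ℕ → AGL n
apow g zero = aone
apow g (suc j) = amul (apow g j) g

asMat : ∀ {n} → Mat n → AGL n
asMat M = M , vzero

asTrans : ∀ {n} → Vec₂ n → AGL n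
asTrans v = mid , v

-- Write g = σ t.  Then g^j = (σ^j , w_j) with w_j = (1 + σ + ⋯ + σ^(j-1)) t, so g^α = (1 , w_α)
-- and g^(2α) = 1: the order of g is α if w_α = 0 and 2α otherwise.  As t is a cyclic vector,
-- w_α = 0 iff f divides G = 1 + x + ⋯ + x^(α-1).  Over F₂,
-- (x - 1) G = x^α - 1 = (x^k - 1)^(2^m) = H (x - 1)^(2^m) with H(1) = 1, and f divides it since
-- σ^α = 1.  Hence f ∣ G = H (x - 1)^(2^m - 1) exactly when (x - 1)^(2^m) ∤ f.
module Submission where

open import Defs
open import Algebra.Bundles using (CommutativeRing; CommutativeSemigroup)
open import Data.Bool using (Bool; true; false; _∧_; _xor_; if_then_else_)
open import Data.Bool.Properties
  using (xor-assoc; xor-comm; xor-same; xor-identityʳ; ∧-comm; ∧-assoc; ∧-identityʳ; ∧-zeroʳ;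
         ∧-distribˡ-xor; ∧-distribʳ-xor; ¬-not; xor-∧-commutativeRing)
open import Data.Nat using (ℕ; zero; suc; pred; _+_; _*_; _^_; _∸_; _<_; >-nonZero)
open import Data.Nat.Properties
  using (+-suc; +-identityʳ; *-identityʳ; *-distribˡ-+; <-cmp; m+[n∸m]≡n; <⇒≤; ≤-trans; m≤m+n;
         m<n⇒0<n∸m; m<n+o⇒m∸n<o; suc-pred; m^n≢0)
open import Data.Nat.Divisibility using (_∣_; divides; ∣-refl; ∣m∣n⇒∣m+n)
open import Data.Fin using (Fin; toℕ; _≟_) renaming (zero to fzero; suc to fsuc)
open import Data.Vec as Vec using (Vec; []; _∷_; tabulate; lookup; zipWith; toList; initLast; _∷ʳ_)
open import Data.Vec.Properties
  using (lookup-map; lookup-zipWith; lookup-replicate; lookup∘tabulate; tabulate∘lookup; tabulate-cong;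
         length-toList; toList-∷ʳ; toList-replicate)
open import Data.List as List using ([]; _∷_; length; _++_)
open import Data.Product using (_×_; ∃; ∃-syntax; ∃₂; _,_; proj₁; proj₂)
open import Data.Empty using (⊥-elim)
open import Function using (_∘_)
open import Relation.Nullary using (¬_; does)
open import Relation.Binary using (Setoid)
import Relation.Binary.Reasoning.Setoid
import Algebra.Properties.CommutativeSemigroup
open import Relation.Binary.Definitions using (tri<; tri≈; tri>)
open import Relation.Binary.PropositionalEquality

module F₂ = CommutativeRing xor-∧-commutativeRing

open Algebra.Properties.CommutativeSemigroup F₂.+-commutativeSemigroup
  using () renaming (interchange to xor-interchange)
open import Algebra.Properties.Semiring.Sum F₂.semiring
  using (sum; sum-syntax; ∑-comm; ∑-distrib-+; *-distribˡ-sum; *-distribʳ-sum; sum-cong-≗; sum-replicate-zero)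

-- Linear algebra over F₂

xor≡false⇒≡ : ∀ {a b} → a xor b ≡ false → a ≡ b
xor≡false⇒≡ {true}  {true}  _ = refl
xor≡false⇒≡ {false} {false} _ = refl
xor≡false⇒≡ {true}  {false} ()
xor≡false⇒≡ {false} {true}  ()

sum-δˡ : ∀ {n} (i : Fin n) (g : Fin n → Bool) → ∑[ k < n ] (does (i ≟ k) ∧ g k) ≡ g i
sum-δˡ {suc n} fzero    g = trans (cong (g fzero xor_) (sum-replicate-zero n)) (xor-identityʳ _)
sum-δˡ {suc n} (fsuc i) g = sum-δˡ i (g ∘ fsuc)

lookup-ext : ∀ {A : Set} {n} {v w : Vec A n} → (∀ i → lookup v i ≡ lookup w i) → v ≡ w
lookup-ext {v = v} {w} eq = trans (sym (tabulate∘lookup v)) (trans (tabulate-cong eq) (tabulate∘lookup w))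

bsum-tabulate : ∀ {n} (g : Fin n → Bool) → bsum (tabulate g) ≡ sum g
bsum-tabulate {zero}  g = refl
bsum-tabulate {suc n} g = cong (g fzero xor_) (bsum-tabulate (g ∘ fsuc))

bsum≡sum∘lookup : ∀ {n} (v : Vec Bool n) → bsum v ≡ sum (lookup v)
bsum≡sum∘lookup []      = refl
bsum≡sum∘lookup (x ∷ v) = cong (x xor_) (bsum≡sum∘lookup v)

entry : ∀ {n} → Mat n → Fin n → Fin n → Bool
entry A i j = lookup (lookup A i) j

lookup-vadd : ∀ {n} (u v : Vec₂ n) i → lookup (vadd u v) i ≡ lookup u i xor lookup v i
lookup-vadd u v i = lookup-zipWith _xor_ i u v

lookup-vzero : ∀ {n} (i : Fin n) → lookup (vzero {n}) i ≡ false
lookup-vzero i = lookup-replicate i false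

lookup-mvec : ∀ {n} (A : Mat n) v i → lookup (mvec A v) i ≡ ∑[ k < n ] (entry A i k ∧ lookup v k)
lookup-mvec A v i = trans (lookup-map i _ A)
  (trans (bsum≡sum∘lookup (zipWith _∧_ (lookup A i) v)) (sum-cong-≗ λ k → lookup-zipWith _∧_ k (lookup A i) v))

entry-mmul : ∀ {n} (A B : Mat n) i j → entry (mmul A B) i j ≡ ∑[ k < n ] (entry A i k ∧ entry B k j)
entry-mmul A B i j = trans (cong (λ r → lookup r j) (lookup∘tabulate _ i))
  (trans (lookup∘tabulate _ j) (bsum-tabulate λ k → entry A i k ∧ entry B k j))

entry-mid : ∀ {n} (i j : Fin n) → entry mid i j ≡ does (i ≟ j)
entry-mid i j = trans (cong (λ r → lookup r j) (lookup∘tabulate _ i)) (lookup∘tabulate _ j)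

entry-mzero : ∀ {n} (i j : Fin n) → entry mzero i j ≡ false
entry-mzero i j = trans (cong (λ r → lookup r j) (lookup-replicate i _)) (lookup-replicate j _)

entry-madd : ∀ {n} (A B : Mat n) i j → entry (madd A B) i j ≡ entry A i j xor entry B i j
entry-madd A B i j =
  trans (cong (λ r → lookup r j) (lookup-zipWith vadd i A B)) (lookup-zipWith _xor_ j (lookup A i) (lookup B i))

vadd-comm : ∀ {n} (u v : Vec₂ n) → vadd u v ≡ vadd v u
vadd-comm u v = lookup-ext λ i → begin
  lookup (vadd u v) i          ≡⟨ lookup-vadd u v i ⟩
  lookup u i xor lookup v i    ≡⟨ xor-comm (lookup u i) (lookup v i) ⟩
  lookup v i xor lookup u i    ≡⟨ lookup-vadd v u i ⟨
  lookup (vadd v u) i          ∎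
  where open ≡-Reasoning

vadd-assoc : ∀ {n} (u v w : Vec₂ n) → vadd (vadd u v) w ≡ vadd u (vadd v w)
vadd-assoc u v w = lookup-ext λ i → begin
  lookup (vadd (vadd u v) w) i                 ≡⟨ lookup-vadd (vadd u v) w i ⟩
  lookup (vadd u v) i xor lookup w i           ≡⟨ cong (_xor lookup w i) (lookup-vadd u v i) ⟩
  (lookup u i xor lookup v i) xor lookup w i   ≡⟨ xor-assoc (lookup u i) (lookup v i) (lookup w i) ⟩
  lookup u i xor (lookup v i xor lookup w i)   ≡⟨ cong (lookup u i xor_) (lookup-vadd v w i) ⟨
  lookup u i xor lookup (vadd v w) i           ≡⟨ lookup-vadd u (vadd v w) i ⟨
  lookup (vadd u (vadd v w)) i                 ∎
  where open ≡-Reasoning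

vadd-identityˡ : ∀ {n} (v : Vec₂ n) → vadd vzero v ≡ v
vadd-identityˡ v = lookup-ext λ i → trans (lookup-vadd vzero v i) (cong (_xor lookup v i) (lookup-vzero i))

vadd-identityʳ : ∀ {n} (v : Vec₂ n) → vadd v vzero ≡ v
vadd-identityʳ v = trans (vadd-comm v vzero) (vadd-identityˡ v)

vadd-self : ∀ {n} (v : Vec₂ n) → vadd v v ≡ vzero
vadd-self v = lookup-ext λ i → trans (lookup-vadd v v i) (trans (xor-same (lookup v i)) (sym (lookup-vzero i)))

vadd-cancelʳ : ∀ {n} {u v : Vec₂ n} w → vadd u w ≡ vadd v w → u ≡ v
vadd-cancelʳ {u = u} {v} w eq = begin
  u                     ≡⟨ cancel u ⟨
  vadd (vadd u w) w     ≡⟨ cong (λ x → vadd x w) eq ⟩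
  vadd (vadd v w) w     ≡⟨ cancel v ⟩
  v                     ∎
  where
  open ≡-Reasoning
  cancel : ∀ x → vadd (vadd x w) w ≡ x
  cancel x = trans (vadd-assoc x w w) (trans (cong (vadd x) (vadd-self w)) (vadd-identityʳ x))

vadd-interchange : ∀ {n} (a b c d : Vec₂ n) → vadd (vadd a b) (vadd c d) ≡ vadd (vadd a c) (vadd b d)
vadd-interchange a b c d = lookup-ext λ i → begin
  lookup (vadd (vadd a b) (vadd c d)) i
    ≡⟨ trans (lookup-vadd (vadd a b) (vadd c d) i) (cong₂ _xor_ (lookup-vadd a b i) (lookup-vadd c d i)) ⟩
  (lookup a i xor lookup b i) xor (lookup c i xor lookup d i)
    ≡⟨ xor-interchange (lookup a i) (lookup b i) (lookup c i) (lookup d i) ⟩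
  (lookup a i xor lookup c i) xor (lookup b i xor lookup d i)
    ≡⟨ trans (lookup-vadd (vadd a c) (vadd b d) i) (cong₂ _xor_ (lookup-vadd a c i) (lookup-vadd b d i)) ⟨
  lookup (vadd (vadd a c) (vadd b d)) i
    ∎
  where open ≡-Reasoning

mvec-vadd : ∀ {n} (A : Mat n) u v → mvec A (vadd u v) ≡ vadd (mvec A u) (mvec A v)
mvec-vadd {n} A u v = lookup-ext λ i → begin
  lookup (mvec A (vadd u v)) i
    ≡⟨ lookup-mvec A (vadd u v) i ⟩
  ∑[ k < n ] (entry A i k ∧ lookup (vadd u v) k)
    ≡⟨ sum-cong-≗ (λ k → trans (cong (entry A i k ∧_) (lookup-vadd u v k))
                                (∧-distribˡ-xor (entry A i k) (lookup u k) (lookup v k))) ⟩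
  ∑[ k < n ] ((entry A i k ∧ lookup u k) xor (entry A i k ∧ lookup v k))
    ≡⟨ ∑-distrib-+ (λ k → entry A i k ∧ lookup u k) (λ k → entry A i k ∧ lookup v k) ⟩
  ∑[ k < n ] (entry A i k ∧ lookup u k) xor ∑[ k < n ] (entry A i k ∧ lookup v k)
    ≡⟨ trans (lookup-vadd (mvec A u) (mvec A v) i) (cong₂ _xor_ (lookup-mvec A u i) (lookup-mvec A v i)) ⟨
  lookup (vadd (mvec A u) (mvec A v)) i
    ∎
  where open ≡-Reasoning

mvec-vzero : ∀ {n} (A : Mat n) → mvec A vzero ≡ vzero
mvec-vzero {n} A = lookup-ext λ i → begin
  lookup (mvec A vzero) i                ≡⟨ lookup-mvec A vzero i ⟩
  ∑[ k < n ] (entry A i k ∧ lookup vzero k) ≡⟨ sum-cong-≗ (λ k → trans (cong (entry A i k ∧_) (lookup-vzero k)) (∧-zeroʳ _)) ⟩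
  ∑[ k < n ] false                       ≡⟨ sum-replicate-zero n ⟩
  false                                  ≡⟨ lookup-vzero i ⟨
  lookup vzero i                         ∎
  where open ≡-Reasoning

mvec-mid : ∀ {n} (v : Vec₂ n) → mvec mid v ≡ v
mvec-mid v = lookup-ext λ i →
  trans (lookup-mvec mid v i) (trans (sum-cong-≗ λ k → cong (_∧ lookup v k) (entry-mid i k)) (sum-δˡ i (lookup v)))

mvec-mzero : ∀ {n} (v : Vec₂ n) → mvec mzero v ≡ vzero
mvec-mzero {n} v = lookup-ext λ i → trans (lookup-mvec mzero v i)
  (trans (sum-cong-≗ λ k → cong (_∧ lookup v k) (entry-mzero i k)) (trans (sum-replicate-zero n) (sym (lookup-vzero i))))

mvec-madd : ∀ {n} (A B : Mat n) v → mvec (madd A B) v ≡ vadd (mvec A v) (mvec B v)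
mvec-madd {n} A B v = lookup-ext λ i → begin
  lookup (mvec (madd A B) v) i
    ≡⟨ lookup-mvec (madd A B) v i ⟩
  ∑[ k < n ] (entry (madd A B) i k ∧ lookup v k)
    ≡⟨ sum-cong-≗ (λ k → trans (cong (_∧ lookup v k) (entry-madd A B i k))
                                (∧-distribʳ-xor (lookup v k) (entry A i k) (entry B i k))) ⟩
  ∑[ k < n ] ((entry A i k ∧ lookup v k) xor (entry B i k ∧ lookup v k))
    ≡⟨ ∑-distrib-+ (λ k → entry A i k ∧ lookup v k) (λ k → entry B i k ∧ lookup v k) ⟩
  ∑[ k < n ] (entry A i k ∧ lookup v k) xor ∑[ k < n ] (entry B i k ∧ lookup v k)
    ≡⟨ trans (lookup-vadd (mvec A v) (mvec B v) i) (cong₂ _xor_ (lookup-mvec A v i) (lookup-mvec B v i)) ⟨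
  lookup (vadd (mvec A v) (mvec B v)) i
    ∎
  where open ≡-Reasoning

mvec-mmul : ∀ {n} (A B : Mat n) v → mvec (mmul A B) v ≡ mvec A (mvec B v)
mvec-mmul {n} A B v = lookup-ext λ i → begin
  lookup (mvec (mmul A B) v) i
    ≡⟨ lookup-mvec (mmul A B) v i ⟩
  ∑[ j < n ] (entry (mmul A B) i j ∧ lookup v j)
    ≡⟨ sum-cong-≗ (λ j → trans (cong (_∧ lookup v j) (entry-mmul A B i j))
                                (*-distribʳ-sum (lookup v j) (λ k → entry A i k ∧ entry B k j))) ⟩
  ∑[ j < n ] ∑[ k < n ] ((entry A i k ∧ entry B k j) ∧ lookup v j)
    ≡⟨ ∑-comm (λ j k → (entry A i k ∧ entry B k j) ∧ lookup v j) ⟩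
  ∑[ k < n ] ∑[ j < n ] ((entry A i k ∧ entry B k j) ∧ lookup v j)
    ≡⟨ sum-cong-≗ (λ k → trans (sum-cong-≗ λ j → ∧-assoc (entry A i k) (entry B k j) (lookup v j))
                                (sym (*-distribˡ-sum (entry A i k) (λ j → entry B k j ∧ lookup v j)))) ⟩
  ∑[ k < n ] (entry A i k ∧ ∑[ j < n ] (entry B k j ∧ lookup v j))
    ≡⟨ sum-cong-≗ (λ k → cong (entry A i k ∧_) (lookup-mvec B v k)) ⟨
  ∑[ k < n ] (entry A i k ∧ lookup (mvec B v) k)
    ≡⟨ lookup-mvec A (mvec B v) i ⟨
  lookup (mvec A (mvec B v)) i
    ∎
  where open ≡-Reasoning

mvec-ext : ∀ {n} {A B : Mat n} → (∀ v → mvec A v ≡ mvec B v) → A ≡ B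
mvec-ext {n} {A} {B} eq = lookup-ext λ i → lookup-ext λ j → begin
  entry A i j               ≡⟨ column A i j ⟨
  lookup (mvec A (e j)) i   ≡⟨ cong (λ w → lookup w i) (eq (e j)) ⟩
  lookup (mvec B (e j)) i   ≡⟨ column B i j ⟩
  entry B i j               ∎
  where
  open ≡-Reasoning
  e : Fin n → Vec₂ n
  e j = tabulate λ k → does (j ≟ k)
  column : ∀ C i j → lookup (mvec C (e j)) i ≡ entry C i j
  column C i j = trans (lookup-mvec C (e j) i) (trans
    (sum-cong-≗ λ k → trans (cong (entry C i k ∧_) (lookup∘tabulate _ k)) (∧-comm (entry C i k) _))
    (sum-δˡ j (entry C i)))

mmul-assoc : ∀ {n} (A B C : Mat n) → mmul (mmul A B) C ≡ mmul A (mmul B C)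
mmul-assoc A B C = mvec-ext λ v → begin
  mvec (mmul (mmul A B) C) v   ≡⟨ mvec-mmul (mmul A B) C v ⟩
  mvec (mmul A B) (mvec C v)   ≡⟨ mvec-mmul A B (mvec C v) ⟩
  mvec A (mvec B (mvec C v))   ≡⟨ cong (mvec A) (mvec-mmul B C v) ⟨
  mvec A (mvec (mmul B C) v)   ≡⟨ mvec-mmul A (mmul B C) v ⟨
  mvec (mmul A (mmul B C)) v   ∎
  where open ≡-Reasoning

mmul-identityˡ : ∀ {n} (A : Mat n) → mmul mid A ≡ A
mmul-identityˡ A = mvec-ext λ v → trans (mvec-mmul mid A v) (mvec-mid (mvec A v))

mmul-identityʳ : ∀ {n} (A : Mat n) → mmul A mid ≡ A
mmul-identityʳ A = mvec-ext λ v → trans (mvec-mmul A mid v) (cong (mvec A) (mvec-mid v))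

mpow-+ : ∀ {n} (A : Mat n) a b → mpow A (a + b) ≡ mmul (mpow A a) (mpow A b)
mpow-+ A a zero    = trans (cong (mpow A) (+-identityʳ a)) (sym (mmul-identityʳ (mpow A a)))
mpow-+ A a (suc b) = begin
  mpow A (a + suc b)                        ≡⟨ cong (mpow A) (+-suc a b) ⟩
  mmul (mpow A (a + b)) A                   ≡⟨ cong (λ B → mmul B A) (mpow-+ A a b) ⟩
  mmul (mmul (mpow A a) (mpow A b)) A       ≡⟨ mmul-assoc (mpow A a) (mpow A b) A ⟩
  mmul (mpow A a) (mpow A (suc b))          ∎
  where open ≡-Reasoning

mpow-sucˡ : ∀ {n} (A : Mat n) j → mpow A (suc j) ≡ mmul A (mpow A j)
mpow-sucˡ A j = trans (mpow-+ A 1 j) (cong (λ B → mmul B (mpow A j)) (mmul-identityˡ A))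

-- Powers in AGL(n,2)

orbitSum : ∀ {n} → Mat n → Vec₂ n → ℕ → Vec₂ n
orbitSum M v zero    = vzero
orbitSum M v (suc j) = vadd (mvec M (orbitSum M v j)) v

apow-pair : ∀ {n} (M : Mat n) v j → apow (M , v) j ≡ (mpow M j , orbitSum M v j)
apow-pair M v zero    = refl
apow-pair M v (suc j) = cong (λ g → amul g (M , v)) (apow-pair M v j)

orbitSum-+ : ∀ {n} (M : Mat n) v a b →
             orbitSum M v (a + b) ≡ vadd (mvec (mpow M b) (orbitSum M v a)) (orbitSum M v b)
orbitSum-+ M v a zero = begin
  orbitSum M v (a + zero)                       ≡⟨ cong (orbitSum M v) (+-identityʳ a) ⟩
  orbitSum M v a                                ≡⟨ mvec-mid (orbitSum M v a) ⟨
  mvec mid (orbitSum M v a)                     ≡⟨ vadd-identityʳ _ ⟨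
  vadd (mvec mid (orbitSum M v a)) vzero        ∎
  where open ≡-Reasoning
orbitSum-+ M v a (suc b) = begin
  orbitSum M v (a + suc b)
    ≡⟨ cong (orbitSum M v) (+-suc a b) ⟩
  vadd (mvec M (orbitSum M v (a + b))) v
    ≡⟨ cong (λ w → vadd (mvec M w) v) (orbitSum-+ M v a b) ⟩
  vadd (mvec M (vadd (mvec (mpow M b) wa) wb)) v
    ≡⟨ cong (λ w → vadd w v) (mvec-vadd M _ wb) ⟩
  vadd (vadd (mvec M (mvec (mpow M b) wa)) (mvec M wb)) v
    ≡⟨ vadd-assoc _ (mvec M wb) v ⟩
  vadd (mvec M (mvec (mpow M b) wa)) (orbitSum M v (suc b))
    ≡⟨ cong (λ w → vadd w (orbitSum M v (suc b))) (trans (cong (λ B → mvec B wa) (mpow-sucˡ M b)) (mvec-mmul M (mpow M b) wa)) ⟨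
  vadd (mvec (mpow M (suc b)) wa) (orbitSum M v (suc b))
    ∎
  where
  open ≡-Reasoning
  wa = orbitSum M v a
  wb = orbitSum M v b

module _ {n} (M : Mat n) (v : Vec₂ n) (α : ℕ) (Mᵅ≡I : mpow M α ≡ mid) where

  mvec-mpow-order : ∀ u → mvec (mpow M α) u ≡ u
  mvec-mpow-order u = trans (cong (λ B → mvec B u) Mᵅ≡I) (mvec-mid u)

  orbitSum-fixed : mvec M (orbitSum M v α) ≡ orbitSum M v α
  orbitSum-fixed = vadd-cancelʳ v (begin
    vadd (mvec M w) v                         ≡⟨ orbitSum-+ M v 1 α ⟩
    vadd (mvec (mpow M α) (orbitSum M v 1)) w ≡⟨ cong (λ u → vadd u w) (mvec-mpow-order (orbitSum M v 1)) ⟩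
    vadd (vadd (mvec M vzero) v) w            ≡⟨ cong (λ u → vadd (vadd u v) w) (mvec-vzero M) ⟩
    vadd (vadd vzero v) w                     ≡⟨ cong (λ u → vadd u w) (vadd-identityˡ v) ⟩
    vadd v w                                  ≡⟨ vadd-comm v w ⟩
    vadd w v                                  ∎)
    where
    open ≡-Reasoning
    w = orbitSum M v α

  orbitSum-double : orbitSum M v (α + α) ≡ vzero
  orbitSum-double = begin
    orbitSum M v (α + α)                                        ≡⟨ orbitSum-+ M v α α ⟩
    vadd (mvec (mpow M α) (orbitSum M v α)) (orbitSum M v α)    ≡⟨ cong (λ u → vadd u (orbitSum M v α)) (mvec-mpow-order _) ⟩
    vadd (orbitSum M v α) (orbitSum M v α)                      ≡⟨ vadd-self _ ⟩
    vzero                                                       ∎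
    where open ≡-Reasoning

module _ {n} (M : Mat n) (v : Vec₂ n) where

  apow-pair≡aone⇒mpow≡mid : ∀ {j} → apow (M , v) j ≡ aone → mpow M j ≡ mid
  apow-pair≡aone⇒mpow≡mid {j} eq = cong proj₁ (trans (sym (apow-pair M v j)) eq)

  orbitSum≡vzero⇒hasOrder : ∀ {α} → HasOrder mid (mpow M) α → orbitSum M v α ≡ vzero →
                            HasOrder aone (apow (M , v)) α
  orbitSum≡vzero⇒hasOrder {α} (α>0 , Mᵅ≡I , minimal) w≡0 =
    α>0 , trans (apow-pair M v α) (cong₂ _,_ Mᵅ≡I w≡0) ,
    λ j j>0 j<α gʲ≡1 → minimal j j>0 j<α (apow-pair≡aone⇒mpow≡mid gʲ≡1)

  orbitSum≢vzero⇒hasOrder-double : ∀ {α} → HasOrder mid (mpow M) α → orbitSum M v α ≢ vzero →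
                                   HasOrder aone (apow (M , v)) (2 * α)
  orbitSum≢vzero⇒hasOrder-double {α} (α>0 , Mᵅ≡I , minimal) w≢0 =
    ≤-trans α>0 (m≤m+n α _) , g²ᵅ≡1 , minimal-double
    where
    2α≡α+α : 2 * α ≡ α + α
    2α≡α+α = cong (α +_) (+-identityʳ α)

    g²ᵅ≡1 : apow (M , v) (2 * α) ≡ aone
    g²ᵅ≡1 = begin
      apow (M , v) (2 * α)                        ≡⟨ cong (apow (M , v)) 2α≡α+α ⟩
      apow (M , v) (α + α)                        ≡⟨ apow-pair M v (α + α) ⟩
      (mpow M (α + α) , orbitSum M v (α + α))     ≡⟨ cong₂ _,_ M²ᵅ≡I (orbitSum-double M v α Mᵅ≡I) ⟩
      aone                                        ∎
      where
      open ≡-Reasoning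
      M²ᵅ≡I : mpow M (α + α) ≡ mid
      M²ᵅ≡I = trans (mpow-+ M α α) (trans (cong₂ mmul Mᵅ≡I Mᵅ≡I) (mmul-identityˡ mid))

    minimal-double : ∀ j → 0 < j → j < 2 * α → apow (M , v) j ≢ aone
    minimal-double j j>0 j<2α gʲ≡1 with <-cmp j α
    ... | tri< j<α _ _ = minimal j j>0 j<α (apow-pair≡aone⇒mpow≡mid gʲ≡1)
    ... | tri≈ _ refl _ = w≢0 (cong proj₂ (trans (sym (apow-pair M v α)) gʲ≡1))
    ... | tri> _ _ α<j = minimal (j ∸ α) (m<n⇒0<n∸m α<j) j∸α<α Mʲ⁻ᵅ≡I
      where
      j∸α<α : j ∸ α < α
      j∸α<α = m<n+o⇒m∸n<o j α {{>-nonZero α>0}} (subst (j <_) 2α≡α+α j<2α)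
      Mʲ⁻ᵅ≡I : mpow M (j ∸ α) ≡ mid
      Mʲ⁻ᵅ≡I = begin
        mpow M (j ∸ α)                      ≡⟨ mmul-identityˡ _ ⟨
        mmul mid (mpow M (j ∸ α))           ≡⟨ cong (λ B → mmul B (mpow M (j ∸ α))) Mᵅ≡I ⟨
        mmul (mpow M α) (mpow M (j ∸ α))    ≡⟨ mpow-+ M α (j ∸ α) ⟨
        mpow M (α + (j ∸ α))                ≡⟨ cong (mpow M) (m+[n∸m]≡n (<⇒≤ α<j)) ⟩
        mpow M j                            ≡⟨ apow-pair≡aone⇒mpow≡mid gʲ≡1 ⟩
        mid                                 ∎
        where open ≡-Reasoning

-- Polynomials over F₂

-- `_≈ₚ_` wrapped in a record, so that both polynomials can be inferred from a proof.
infix 4 _≋_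
record _≋_ (p q : Poly) : Set where
  constructor mk≋
  field coeff≡ : p ≈ₚ q
open _≋_ public

≋-refl : ∀ {p} → p ≋ p
≋-refl = mk≋ λ _ → refl

≋-sym : ∀ {p q} → p ≋ q → q ≋ p
≋-sym p≋q = mk≋ λ i → sym (coeff≡ p≋q i)

≋-trans : ∀ {p q r} → p ≋ q → q ≋ r → p ≋ r
≋-trans p≋q q≋r = mk≋ λ i → trans (coeff≡ p≋q i) (coeff≡ q≋r i)

≡⇒≋ : ∀ {p q} → p ≡ q → p ≋ q
≡⇒≋ refl = ≋-refl

≋-setoid : Setoid _ _
≋-setoid = record
  { Carrier = Poly ; _≈_ = _≋_
  ; isEquivalence = record { refl = ≋-refl ; sym = ≋-sym ; trans = ≋-trans } }

module ≋-Reasoning = Relation.Binary.Reasoning.Setoid ≋-setoid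

∷-cong : ∀ {a b p q} → a ≡ b → p ≋ q → (a ∷ p) ≋ (b ∷ q)
∷-cong a≡b p≋q = mk≋ λ { zero → a≡b ; (suc i) → coeff≡ p≋q i }

∷-tail : ∀ {a b p q} → (a ∷ p) ≋ (b ∷ q) → p ≋ q
∷-tail e = mk≋ λ i → coeff≡ e (suc i)

∷≋[]-tail : ∀ {a p} → (a ∷ p) ≋ [] → p ≋ []
∷≋[]-tail e = mk≋ λ i → coeff≡ e (suc i)

false∷≋[] : ∀ {p} → p ≋ [] → (false ∷ p) ≋ []
false∷≋[] p≋[] = mk≋ λ { zero → refl ; (suc i) → coeff≡ p≋[] i }

coeff-padd : ∀ p q i → coeff (padd p q) i ≡ coeff p i xor coeff q i
coeff-padd []      q       i       = refl
coeff-padd (a ∷ p) []      zero    = sym (xor-identityʳ a)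
coeff-padd (a ∷ p) []      (suc i) = sym (xor-identityʳ _)
coeff-padd (a ∷ p) (b ∷ q) zero    = refl
coeff-padd (a ∷ p) (b ∷ q) (suc i) = coeff-padd p q i

coeff-pscale : ∀ a q i → coeff (pscale a q) i ≡ a ∧ coeff q i
coeff-pscale a []      i       = sym (∧-zeroʳ a)
coeff-pscale a (b ∷ q) zero    = refl
coeff-pscale a (b ∷ q) (suc i) = coeff-pscale a q i

padd-cong : ∀ {p p' q q'} → p ≋ p' → q ≋ q' → padd p q ≋ padd p' q'
padd-cong {p} {p'} {q} {q'} p≋p' q≋q' = mk≋ λ i →
  trans (coeff-padd p q i) (trans (cong₂ _xor_ (coeff≡ p≋p' i) (coeff≡ q≋q' i)) (sym (coeff-padd p' q' i)))

padd-congˡ : ∀ {p p'} q → p ≋ p' → padd p q ≋ padd p' q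
padd-congˡ q p≋p' = padd-cong p≋p' (≋-refl {q})

padd-congʳ : ∀ p {q q'} → q ≋ q' → padd p q ≋ padd p q'
padd-congʳ p q≋q' = padd-cong (≋-refl {p}) q≋q'

padd-comm : ∀ p q → padd p q ≋ padd q p
padd-comm p q = mk≋ λ i →
  trans (coeff-padd p q i) (trans (xor-comm (coeff p i) (coeff q i)) (sym (coeff-padd q p i)))

padd-assoc : ∀ p q r → padd (padd p q) r ≋ padd p (padd q r)
padd-assoc p q r = mk≋ λ i → begin
  coeff (padd (padd p q) r) i                ≡⟨ trans (coeff-padd (padd p q) r i) (cong (_xor coeff r i) (coeff-padd p q i)) ⟩
  (coeff p i xor coeff q i) xor coeff r i    ≡⟨ xor-assoc (coeff p i) (coeff q i) (coeff r i) ⟩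
  coeff p i xor (coeff q i xor coeff r i)    ≡⟨ trans (coeff-padd p (padd q r) i) (cong (coeff p i xor_) (coeff-padd q r i)) ⟨
  coeff (padd p (padd q r)) i                ∎
  where open ≡-Reasoning

padd-identityʳ : ∀ p → padd p [] ≋ p
padd-identityʳ p = mk≋ λ i → trans (coeff-padd p [] i) (xor-identityʳ _)

padd-self : ∀ p → padd p p ≋ []
padd-self p = mk≋ λ i → trans (coeff-padd p p i) (xor-same (coeff p i))

padd≋[]⇒≋ : ∀ {p q} → padd p q ≋ [] → p ≋ q
padd≋[]⇒≋ {p} {q} p+q≋[] = mk≋ λ i → xor≡false⇒≡ (trans (sym (coeff-padd p q i)) (coeff≡ p+q≋[] i))

padd-commutativeSemigroup : CommutativeSemigroup _ _
padd-commutativeSemigroup = record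
  { Carrier = Poly ; _≈_ = _≋_ ; _∙_ = padd
  ; isCommutativeSemigroup = record
    { isSemigroup = record
      { isMagma = record { isEquivalence = Setoid.isEquivalence ≋-setoid ; ∙-cong = padd-cong }
      ; assoc = padd-assoc }
    ; comm = padd-comm } }

module Padd = Algebra.Properties.CommutativeSemigroup padd-commutativeSemigroup

pscale-cong : ∀ a {q q'} → q ≋ q' → pscale a q ≋ pscale a q'
pscale-cong a {q} {q'} q≋q' = mk≋ λ i →
  trans (coeff-pscale a q i) (trans (cong (a ∧_) (coeff≡ q≋q' i)) (sym (coeff-pscale a q' i)))

pscale-false : ∀ q → pscale false q ≋ []
pscale-false q = mk≋ (coeff-pscale false q)

pscale-true : ∀ q → pscale true q ≋ q
pscale-true q = mk≋ (coeff-pscale true q)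

pscale-distrib-xor : ∀ a b q → pscale (a xor b) q ≋ padd (pscale a q) (pscale b q)
pscale-distrib-xor a b q = mk≋ λ i → begin
  coeff (pscale (a xor b) q) i                   ≡⟨ coeff-pscale (a xor b) q i ⟩
  (a xor b) ∧ coeff q i                          ≡⟨ ∧-distribʳ-xor (coeff q i) a b ⟩
  (a ∧ coeff q i) xor (b ∧ coeff q i)            ≡⟨ cong₂ _xor_ (coeff-pscale a q i) (coeff-pscale b q i) ⟨
  coeff (pscale a q) i xor coeff (pscale b q) i  ≡⟨ coeff-padd (pscale a q) (pscale b q) i ⟨
  coeff (padd (pscale a q) (pscale b q)) i       ∎
  where open ≡-Reasoning

pscale-padd : ∀ a p q → pscale a (padd p q) ≋ padd (pscale a p) (pscale a q)
pscale-padd a p q = mk≋ λ i → begin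
  coeff (pscale a (padd p q)) i                  ≡⟨ trans (coeff-pscale a (padd p q) i) (cong (a ∧_) (coeff-padd p q i)) ⟩
  a ∧ (coeff p i xor coeff q i)                  ≡⟨ ∧-distribˡ-xor a (coeff p i) (coeff q i) ⟩
  (a ∧ coeff p i) xor (a ∧ coeff q i)            ≡⟨ cong₂ _xor_ (coeff-pscale a p i) (coeff-pscale a q i) ⟨
  coeff (pscale a p) i xor coeff (pscale a q) i  ≡⟨ coeff-padd (pscale a p) (pscale a q) i ⟨
  coeff (padd (pscale a p) (pscale a q)) i       ∎
  where open ≡-Reasoning

pscale-pscale : ∀ a b q → pscale (a ∧ b) q ≋ pscale a (pscale b q)
pscale-pscale a b q = mk≋ λ i →
  trans (coeff-pscale (a ∧ b) q i)
        (trans (∧-assoc a b _) (sym (trans (coeff-pscale a (pscale b q) i) (cong (a ∧_) (coeff-pscale b q i)))))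

pmul-zeroˡ : ∀ {p} q → p ≋ [] → pmul p q ≋ []
pmul-zeroˡ {[]}    q _    = ≋-refl
pmul-zeroˡ {a ∷ p} q a∷p≋[] = padd-cong a·q≋[] (false∷≋[] (pmul-zeroˡ q (∷≋[]-tail a∷p≋[])))
  where
  a·q≋[] : pscale a q ≋ []
  a·q≋[] = subst (λ b → pscale b q ≋ []) (sym (coeff≡ a∷p≋[] zero)) (pscale-false q)

pmul-zeroʳ : ∀ p → pmul p [] ≋ []
pmul-zeroʳ []      = ≋-refl
pmul-zeroʳ (a ∷ p) = false∷≋[] (pmul-zeroʳ p)

pmul-congˡ : ∀ {p p'} q → p ≋ p' → pmul p q ≋ pmul p' q
pmul-congˡ {[]}    {p'}     q p≋p' = ≋-sym (pmul-zeroˡ q (≋-sym p≋p'))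
pmul-congˡ {a ∷ p} {[]}     q p≋p' = pmul-zeroˡ q p≋p'
pmul-congˡ {a ∷ p} {b ∷ p'} q p≋p' rewrite coeff≡ p≋p' zero =
  padd-cong ≋-refl (∷-cong refl (pmul-congˡ q (∷-tail p≋p')))

pmul-congʳ : ∀ p {q q'} → q ≋ q' → pmul p q ≋ pmul p q'
pmul-congʳ []      q≋q' = ≋-refl
pmul-congʳ (a ∷ p) q≋q' = padd-cong (pscale-cong a q≋q') (∷-cong refl (pmul-congʳ p q≋q'))

pmul-cong : ∀ {p p' q q'} → p ≋ p' → q ≋ q' → pmul p q ≋ pmul p' q'
pmul-cong {p' = p'} {q} p≋p' q≋q' = ≋-trans (pmul-congˡ q p≋p') (pmul-congʳ p' q≋q')

pmul-false∷ : ∀ p q → pmul (false ∷ p) q ≋ (false ∷ pmul p q)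
pmul-false∷ p q = padd-cong (pscale-false q) ≋-refl

pmul-distribʳ : ∀ p₁ p₂ q → pmul (padd p₁ p₂) q ≋ padd (pmul p₁ q) (pmul p₂ q)
pmul-distribʳ []       p₂       q = ≋-refl
pmul-distribʳ (a ∷ p₁) []       q = ≋-sym (padd-identityʳ _)
pmul-distribʳ (a ∷ p₁) (b ∷ p₂) q =
  ≋-trans (padd-cong (pscale-distrib-xor a b q) (∷-cong refl (pmul-distribʳ p₁ p₂ q)))
          (Padd.interchange (pscale a q) (pscale b q) (false ∷ pmul p₁ q) (false ∷ pmul p₂ q))

pmul-∷ʳ : ∀ p b q → pmul p (b ∷ q) ≋ padd (pscale b p) (false ∷ pmul p q)
pmul-∷ʳ []      b q = mk≋ λ { zero → refl ; (suc i) → refl }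
pmul-∷ʳ (a ∷ p) b q = ∷-cong (trans (xor-identityʳ _) (trans (∧-comm a b) (sym (xor-identityʳ _))))
  (≋-trans (padd-cong ≋-refl (pmul-∷ʳ p b q)) (Padd.x∙yz≈y∙xz (pscale a q) (pscale b p) (false ∷ pmul p q)))

pmul-comm : ∀ p q → pmul p q ≋ pmul q p
pmul-comm []      q = ≋-sym (pmul-zeroʳ q)
pmul-comm (a ∷ p) q = ≋-trans (padd-cong ≋-refl (∷-cong refl (pmul-comm p q))) (≋-sym (pmul-∷ʳ q a p))

pmul-pscale : ∀ a p q → pmul (pscale a p) q ≋ pscale a (pmul p q)
pmul-pscale a []      q = ≋-refl
pmul-pscale a (b ∷ p) q =
  ≋-trans (padd-cong (pscale-pscale a b q) (∷-cong (sym (∧-zeroʳ a)) (pmul-pscale a p q)))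
          (≋-sym (pscale-padd a (pscale b q) (false ∷ pmul p q)))

pmul-assoc : ∀ p q r → pmul (pmul p q) r ≋ pmul p (pmul q r)
pmul-assoc []      q r = ≋-refl
pmul-assoc (a ∷ p) q r = ≋-trans (pmul-distribʳ (pscale a q) (false ∷ pmul p q) r)
  (padd-cong (pmul-pscale a q r) (≋-trans (pmul-false∷ (pmul p q) r) (∷-cong refl (pmul-assoc p q r))))

pmul-identityˡ : ∀ q → pmul pone q ≋ q
pmul-identityˡ q = ≋-trans (padd-cong (pscale-true q) (false∷≋[] ≋-refl)) (padd-identityʳ q)

pmul-identityʳ : ∀ q → pmul q pone ≋ q
pmul-identityʳ q = ≋-trans (pmul-comm q pone) (pmul-identityˡ q)

pmul-commutativeSemigroup : CommutativeSemigroup _ _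
pmul-commutativeSemigroup = record
  { Carrier = Poly ; _≈_ = _≋_ ; _∙_ = pmul
  ; isCommutativeSemigroup = record
    { isSemigroup = record
      { isMagma = record { isEquivalence = Setoid.isEquivalence ≋-setoid ; ∙-cong = pmul-cong }
      ; assoc = pmul-assoc }
    ; comm = pmul-comm } }

module Pmul = Algebra.Properties.CommutativeSemigroup pmul-commutativeSemigroup

eval1 : Poly → Bool
eval1 []      = false
eval1 (a ∷ p) = a xor eval1 p

eval1-padd : ∀ p q → eval1 (padd p q) ≡ eval1 p xor eval1 q
eval1-padd []      q       = refl
eval1-padd (a ∷ p) []      = sym (xor-identityʳ _)
eval1-padd (a ∷ p) (b ∷ q) = trans (cong ((a xor b) xor_) (eval1-padd p q)) (xor-interchange a b (eval1 p) (eval1 q))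

eval1-pscale : ∀ a q → eval1 (pscale a q) ≡ a ∧ eval1 q
eval1-pscale a []      = sym (∧-zeroʳ a)
eval1-pscale a (b ∷ q) = trans (cong ((a ∧ b) xor_) (eval1-pscale a q)) (sym (∧-distribˡ-xor a b (eval1 q)))

eval1-pmul : ∀ p q → eval1 (pmul p q) ≡ eval1 p ∧ eval1 q
eval1-pmul []      q = refl
eval1-pmul (a ∷ p) q = begin
  eval1 (padd (pscale a q) (false ∷ pmul p q))   ≡⟨ eval1-padd (pscale a q) (false ∷ pmul p q) ⟩
  eval1 (pscale a q) xor eval1 (pmul p q)        ≡⟨ cong₂ _xor_ (eval1-pscale a q) (eval1-pmul p q) ⟩
  (a ∧ eval1 q) xor (eval1 p ∧ eval1 q)          ≡⟨ ∧-distribʳ-xor (eval1 q) a (eval1 p) ⟨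
  (a xor eval1 p) ∧ eval1 q                      ∎
  where open ≡-Reasoning

eval1-≋[] : ∀ {p} → p ≋ [] → eval1 p ≡ false
eval1-≋[] {[]}    _      = refl
eval1-≋[] {a ∷ p} a∷p≋[] = cong₂ _xor_ (coeff≡ a∷p≋[] zero) (eval1-≋[] (∷≋[]-tail a∷p≋[]))

eval1-cong : ∀ {p q} → p ≋ q → eval1 p ≡ eval1 q
eval1-cong {p} {q} p≋q = xor≡false⇒≡ (trans (sym (eval1-padd p q)) (eval1-≋[] (≋-trans (padd-cong p≋q ≋-refl) (padd-self q))))

eval1-pmul-xMinus1 : ∀ p → eval1 (pmul p xMinus1) ≡ false
eval1-pmul-xMinus1 p = trans (eval1-pmul p xMinus1) (∧-zeroʳ _)

pmul-xMinus1 : ∀ q → pmul q xMinus1 ≋ padd q (false ∷ q)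
pmul-xMinus1 q = ≋-trans (pmul-∷ʳ q true (true ∷ [])) (padd-cong (pscale-true q) (∷-cong refl (pmul-identityʳ q)))

pmul-xMinus1≋[]⇒≋[] : ∀ {q} → pmul q xMinus1 ≋ [] → q ≋ []
pmul-xMinus1≋[]⇒≋[] {q} qX≋[] = mk≋ coeff-zero
  where
  q+xq≋[] : padd q (false ∷ q) ≋ []
  q+xq≋[] = ≋-trans (≋-sym (pmul-xMinus1 q)) qX≋[]
  coeff-zero : ∀ i → coeff q i ≡ false
  coeff-zero zero    = trans (sym (xor-identityʳ _)) (trans (sym (coeff-padd q (false ∷ q) zero)) (coeff≡ q+xq≋[] zero))
  coeff-zero (suc i) = xor≡false⇒≡ (trans (cong (coeff q (suc i) xor_) (sym (coeff-zero i)))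
    (trans (sym (coeff-padd q (false ∷ q) (suc i))) (coeff≡ q+xq≋[] (suc i))))

pmul-cancelʳ-xMinus1 : ∀ {p q} → pmul p xMinus1 ≋ pmul q xMinus1 → p ≋ q
pmul-cancelʳ-xMinus1 {p} {q} pX≋qX = padd≋[]⇒≋ (pmul-xMinus1≋[]⇒≋[] (begin
  pmul (padd p q) xMinus1                   ≈⟨ pmul-distribʳ p q xMinus1 ⟩
  padd (pmul p xMinus1) (pmul q xMinus1)    ≈⟨ padd-cong pX≋qX ≋-refl ⟩
  padd (pmul q xMinus1) (pmul q xMinus1)    ≈⟨ padd-self (pmul q xMinus1) ⟩
  []                                        ∎))
  where open ≋-Reasoning

pmul-cancelʳ-xMinus1^ : ∀ a {p q} → pmul p (ppow xMinus1 a) ≋ pmul q (ppow xMinus1 a) → p ≋ q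
pmul-cancelʳ-xMinus1^ zero    {p} {q} eq = ≋-trans (≋-sym (pmul-identityʳ p)) (≋-trans eq (pmul-identityʳ q))
pmul-cancelʳ-xMinus1^ (suc a) {p} {q} eq = pmul-cancelʳ-xMinus1^ a (pmul-cancelʳ-xMinus1
  (≋-trans (pmul-assoc p (ppow xMinus1 a) xMinus1) (≋-trans eq (≋-sym (pmul-assoc q (ppow xMinus1 a) xMinus1)))))

deflate : Poly → Poly
deflate []      = []
deflate (a ∷ p) = eval1 p ∷ deflate p

deflate-spec : ∀ p → padd (deflate p) (eval1 p ∷ deflate p) ≋ p
deflate-spec []      = false∷≋[] ≋-refl
deflate-spec (a ∷ p) = ∷-cong (cancel (eval1 p) a) (deflate-spec p)
  where
  cancel : ∀ e a → e xor (a xor e) ≡ a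
  cancel e a = trans (cong (e xor_) (xor-comm a e)) (trans (sym (xor-assoc e e a)) (cong (_xor a) (xor-same e)))

pmul-deflate : ∀ p → eval1 p ≡ false → pmul (deflate p) xMinus1 ≋ p
pmul-deflate p p₁≡0 = ≋-trans (pmul-xMinus1 (deflate p))
  (subst (λ e → padd (deflate p) (e ∷ deflate p) ≋ p) p₁≡0 (deflate-spec p))

infix 4 _∣≋_
_∣≋_ : Poly → Poly → Set
g ∣≋ h = ∃ λ q → pmul q g ≋ h

∣≋⇒∣ₚ : ∀ {g h} → g ∣≋ h → g ∣ₚ h
∣≋⇒∣ₚ (q , qg≋h) = q , coeff≡ qg≋h

∣ₚ⇒∣≋ : ∀ {g h} → g ∣ₚ h → g ∣≋ h
∣ₚ⇒∣≋ (q , qg≈h) = q , mk≋ qg≈h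

∣≋-respʳ : ∀ {g h h'} → g ∣≋ h → h ≋ h' → g ∣≋ h'
∣≋-respʳ (q , qg≋h) h≋h' = q , ≋-trans qg≋h h≋h'

∣≋-respˡ : ∀ {g g' h} → g ≋ g' → g ∣≋ h → g' ∣≋ h
∣≋-respˡ g≋g' (q , qg≋h) = q , ≋-trans (pmul-congʳ q (≋-sym g≋g')) qg≋h

∣≋-trans : ∀ {f g h} → f ∣≋ g → g ∣≋ h → f ∣≋ h
∣≋-trans {f} (p , pf≋g) (q , qg≋h) = pmul q p , ≋-trans (pmul-assoc q p f) (≋-trans (pmul-congʳ q pf≋g) qg≋h)

∣≋-pmulʳ : ∀ {g h} c → g ∣≋ h → pmul g c ∣≋ pmul h c
∣≋-pmulʳ {g} c (q , qg≋h) = q , ≋-trans (≋-sym (pmul-assoc q g c)) (pmul-congˡ c qg≋h)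

∣≋-cancelʳ-xMinus1 : ∀ {g h} → pmul g xMinus1 ∣≋ pmul h xMinus1 → g ∣≋ h
∣≋-cancelʳ-xMinus1 {g} (q , qgX≋hX) = q , pmul-cancelʳ-xMinus1 (≋-trans (pmul-assoc q g xMinus1) qgX≋hX)

eval1≡true⇒∣≋-cancelʳ-xMinus1 : ∀ {f g} → eval1 f ≡ true → f ∣≋ pmul g xMinus1 → f ∣≋ g
eval1≡true⇒∣≋-cancelʳ-xMinus1 {f} {g} f₁≡1 (q , qf≋gX) =
  deflate q , pmul-cancelʳ-xMinus1 (begin
    pmul (pmul (deflate q) f) xMinus1     ≈⟨ Pmul.xy∙z≈xz∙y (deflate q) f xMinus1 ⟩
    pmul (pmul (deflate q) xMinus1) f     ≈⟨ pmul-congˡ f (pmul-deflate q q₁≡0) ⟩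
    pmul q f                              ≈⟨ qf≋gX ⟩
    pmul g xMinus1                        ∎)
  where
  open ≋-Reasoning
  q₁≡0 : eval1 q ≡ false
  q₁≡0 = trans (sym (trans (eval1-pmul q f) (trans (cong (eval1 q ∧_) f₁≡1) (∧-identityʳ _))))
               (trans (eval1-cong qf≋gX) (eval1-pmul-xMinus1 g))

pmul-xMinus1^-suc : ∀ g a → pmul g (ppow xMinus1 (suc a)) ≋ pmul (pmul g (ppow xMinus1 a)) xMinus1
pmul-xMinus1^-suc g a = ≋-sym (pmul-assoc g (ppow xMinus1 a) xMinus1)

-- If f(1) = 1 then f is coprime to x - 1; otherwise f = f' (x - 1) and we recurse on f'.
∣≋-reduce-xMinus1^ : ∀ a {f g} → ¬ ppow xMinus1 (suc a) ∣≋ f →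
                     f ∣≋ pmul g (ppow xMinus1 (suc a)) → f ∣≋ pmul g (ppow xMinus1 a)
∣≋-reduce-xMinus1^ a {f} {g} X^a+1∤f f∣gXᵃ⁺¹ with eval1 f in f₁
... | true  = eval1≡true⇒∣≋-cancelʳ-xMinus1 f₁ (∣≋-respʳ f∣gXᵃ⁺¹ (pmul-xMinus1^-suc g a))
... | false = reduce a X^a+1∤f f'∣gXᵃ
  where
  f' = deflate f
  f'X≋f : pmul f' xMinus1 ≋ f
  f'X≋f = pmul-deflate f f₁
  f'∣gXᵃ : f' ∣≋ pmul g (ppow xMinus1 a)
  f'∣gXᵃ = ∣≋-cancelʳ-xMinus1 (∣≋-respˡ (≋-sym f'X≋f) (∣≋-respʳ f∣gXᵃ⁺¹ (pmul-xMinus1^-suc g a)))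
  reduce : ∀ a → ¬ ppow xMinus1 (suc a) ∣≋ f → f' ∣≋ pmul g (ppow xMinus1 a) → f ∣≋ pmul g (ppow xMinus1 a)
  reduce zero    X∤f _       = ⊥-elim (X∤f (f' , ≋-trans (pmul-congʳ f' (pmul-identityˡ xMinus1)) f'X≋f))
  reduce (suc a) X^a+2∤f f'∣ = ∣≋-respˡ f'X≋f (∣≋-respʳ (∣≋-pmulʳ xMinus1 (∣≋-reduce-xMinus1^ a {g = g} X^a+1∤f' f'∣))
                                                         (≋-sym (pmul-xMinus1^-suc g a)))
    where
    X^a+1∤f' : ¬ ppow xMinus1 (suc a) ∣≋ f'
    X^a+1∤f' (q , qXᵃ⁺¹≋f') = X^a+2∤f (q , ≋-trans (≋-sym (pmul-assoc q (ppow xMinus1 (suc a)) xMinus1))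
                                                   (≋-trans (pmul-congˡ xMinus1 qXᵃ⁺¹≋f') f'X≋f))

xMinus1^∣⇒∤ : ∀ e {f H} → eval1 H ≡ true → ppow xMinus1 (suc e) ∣≋ f → ¬ f ∣≋ pmul H (ppow xMinus1 e)
xMinus1^∣⇒∤ e {H = H} H₁≡1 Xᵉ⁺¹∣f f∣HXᵉ with ∣≋-trans Xᵉ⁺¹∣f f∣HXᵉ
... | Q , QXᵉ⁺¹≋HXᵉ = false≢true (trans (sym (eval1-pmul-xMinus1 Q)) (trans (eval1-cong QX≋H) H₁≡1))
  where
  QX≋H : pmul Q xMinus1 ≋ H
  QX≋H = pmul-cancelʳ-xMinus1^ e (≋-trans (≋-sym (Pmul.x∙yz≈xz∙y Q (ppow xMinus1 e) xMinus1)) QXᵉ⁺¹≋HXᵉ)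
  false≢true : false ≢ true
  false≢true ()

-- Geometric sums

ppow-+ : ∀ p a b → ppow p (a + b) ≋ pmul (ppow p a) (ppow p b)
ppow-+ p zero    b = ≋-sym (pmul-identityˡ (ppow p b))
ppow-+ p (suc a) b = begin
  pmul (ppow p (a + b)) p               ≈⟨ pmul-congˡ p (ppow-+ p a b) ⟩
  pmul (pmul (ppow p a) (ppow p b)) p   ≈⟨ Pmul.xy∙z≈xz∙y (ppow p a) (ppow p b) p ⟩
  pmul (pmul (ppow p a) p) (ppow p b)   ∎
  where open ≋-Reasoning

geom : ℕ → Poly
geom j = List.replicate j true

shift : ℕ → Poly → Poly
shift j p = List.replicate j false ++ p

shift≋pmul-shift-pone : ∀ j q → shift j q ≋ pmul (shift j pone) q
shift≋pmul-shift-pone zero    q = ≋-sym (pmul-identityˡ q)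
shift≋pmul-shift-pone (suc j) q = ≋-trans (∷-cong refl (shift≋pmul-shift-pone j q)) (≋-sym (pmul-false∷ (shift j pone) q))

pmul-geom-xMinus1 : ∀ j → pmul (geom j) xMinus1 ≋ padd pone (shift j pone)
pmul-geom-xMinus1 j = ≋-trans (pmul-xMinus1 (geom j)) (≡⇒≋ (telescope j))
  where
  telescope′ : ∀ j → padd (geom j) (true ∷ geom j) ≡ shift j pone
  telescope′ zero    = refl
  telescope′ (suc j) = cong (false ∷_) (telescope′ j)
  telescope : ∀ j → padd (geom j) (false ∷ geom j) ≡ padd pone (shift j pone)
  telescope zero    = refl
  telescope (suc j) = cong (true ∷_) (telescope′ j)

geom-+-self : ∀ j → geom (j + j) ≋ pmul (pmul (geom j) xMinus1) (geom j)
geom-+-self j = begin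
  geom (j + j)                                              ≡⟨ replicate-+ j ⟩
  geom j ++ geom j                                          ≡⟨ padd-geom-shift j ⟨
  padd (geom j) (shift j (geom j))                          ≈⟨ padd-cong (≋-sym (pmul-identityˡ (geom j))) (shift≋pmul-shift-pone j (geom j)) ⟩
  padd (pmul pone (geom j)) (pmul (shift j pone) (geom j))  ≈⟨ pmul-distribʳ pone (shift j pone) (geom j) ⟨
  pmul (padd pone (shift j pone)) (geom j)                  ≈⟨ pmul-congˡ (geom j) (pmul-geom-xMinus1 j) ⟨
  pmul (pmul (geom j) xMinus1) (geom j)                     ∎
  where
  open ≋-Reasoning
  replicate-+ : ∀ a {b} → List.replicate (a + b) true ≡ geom a ++ geom b
  replicate-+ zero    = refl
  replicate-+ (suc a) = cong (true ∷_) (replicate-+ a)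
  padd-geom-shift : ∀ a {L} → padd (geom a) (shift a L) ≡ geom a ++ L
  padd-geom-shift zero    = refl
  padd-geom-shift (suc a) = cong (true ∷_) (padd-geom-shift a)

eval1-geom-even : ∀ k → eval1 (geom k) ≡ false → 2 ∣ k
eval1-geom-even zero          _   = divides 0 refl
eval1-geom-even (suc zero)    ()
eval1-geom-even (suc (suc k)) eq = ∣m∣n⇒∣m+n ∣-refl (eval1-geom-even k (trans (xor-assoc true true _) eq))

eval1-geom-odd : ∀ {k} → ¬ 2 ∣ k → eval1 (geom k) ≡ true
eval1-geom-odd {k} k-odd = ¬-not (k-odd ∘ eval1-geom-even k)

-- Induction on m: in characteristic 2, (x - 1) G(2j) = ((x - 1) G(j))², where G(j) = geom j.
geom-odd*2^m-factor : ∀ {k} → ¬ 2 ∣ k → ∀ m →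
  ∃[ H ] eval1 H ≡ true × pmul (geom (k * 2 ^ m)) xMinus1 ≋ pmul H (ppow xMinus1 (2 ^ m))
geom-odd*2^m-factor {k} k-odd zero =
  geom k , eval1-geom-odd k-odd ,
  ≋-trans (≡⇒≋ (cong (λ j → pmul (geom j) xMinus1) (*-identityʳ k))) (pmul-congʳ (geom k) (≋-sym (pmul-identityˡ xMinus1)))
geom-odd*2^m-factor {k} k-odd (suc m) with geom-odd*2^m-factor k-odd m
... | H , H₁≡1 , factor = pmul H H , trans (eval1-pmul H H) (cong₂ _∧_ H₁≡1 H₁≡1) , (begin
  pmul (geom (k * 2 ^ suc m)) xMinus1                       ≡⟨ cong (λ i → pmul (geom i) xMinus1) k*2^[m+1]≡j+j ⟩
  pmul (geom (j + j)) xMinus1                               ≈⟨ pmul-congˡ xMinus1 (geom-+-self j) ⟩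
  pmul (pmul (pmul (geom j) xMinus1) (geom j)) xMinus1      ≈⟨ pmul-assoc (pmul (geom j) xMinus1) (geom j) xMinus1 ⟩
  pmul (pmul (geom j) xMinus1) (pmul (geom j) xMinus1)      ≈⟨ pmul-cong factor factor ⟩
  pmul (pmul H Xᵉ) (pmul H Xᵉ)                              ≈⟨ Pmul.interchange H Xᵉ H Xᵉ ⟩
  pmul (pmul H H) (pmul Xᵉ Xᵉ)                              ≈⟨ pmul-congʳ (pmul H H) (ppow-+ xMinus1 (2 ^ m) (2 ^ m)) ⟨
  pmul (pmul H H) (ppow xMinus1 (2 ^ m + 2 ^ m))            ≡⟨ cong (λ i → pmul (pmul H H) (ppow xMinus1 i)) 2^m+2^m≡2^[m+1] ⟩
  pmul (pmul H H) (ppow xMinus1 (2 ^ suc m))                ∎)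
  where
  open ≋-Reasoning
  j = k * 2 ^ m
  Xᵉ = ppow xMinus1 (2 ^ m)
  2^m+2^m≡2^[m+1] : 2 ^ m + 2 ^ m ≡ 2 ^ suc m
  2^m+2^m≡2^[m+1] = cong (2 ^ m +_) (sym (+-identityʳ (2 ^ m)))
  k*2^[m+1]≡j+j : k * 2 ^ suc m ≡ j + j
  k*2^[m+1]≡j+j = trans (cong (k *_) (sym 2^m+2^m≡2^[m+1])) (*-distribˡ-+ k (2 ^ m) (2 ^ m))

-- Polynomials acting on vectors

vscale : ∀ {n} → Bool → Vec₂ n → Vec₂ n
vscale a v = if a then v else vzero

vscale-xor : ∀ {n} a b (v : Vec₂ n) → vscale (a xor b) v ≡ vadd (vscale a v) (vscale b v)
vscale-xor true  true  v = sym (vadd-self v)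
vscale-xor true  false v = sym (vadd-identityʳ v)
vscale-xor false b     v = sym (vadd-identityˡ _)

mvec-vscale : ∀ {n} (A : Mat n) a v → mvec A (vscale a v) ≡ vscale a (mvec A v)
mvec-vscale A true  v = refl
mvec-vscale A false v = mvec-vzero A

mvec-if : ∀ {n} a (v : Vec₂ n) → mvec (if a then mid else mzero) v ≡ vscale a v
mvec-if true  v = mvec-mid v
mvec-if false v = mvec-mzero v

lincomb-cong : ∀ {n m} (c : Vec Bool m) {b b' : Fin m → Vec₂ n} → (∀ i → b i ≡ b' i) → lincomb c b ≡ lincomb c b'
lincomb-cong []      _  = refl
lincomb-cong (a ∷ c) eq = cong₂ vadd (cong (vscale a) (eq fzero)) (lincomb-cong c (eq ∘ fsuc))

module PolyAction {n} (M : Mat n) where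

  act : Poly → Vec₂ n → Vec₂ n
  act p v = mvec (peval M p) v

  act-[] : ∀ v → act [] v ≡ vzero
  act-[] = mvec-mzero

  act-∷ : ∀ a p v → act (a ∷ p) v ≡ vadd (vscale a v) (mvec M (act p v))
  act-∷ a p v = trans (mvec-madd _ _ v) (cong₂ vadd (mvec-if a v) (mvec-mmul M (peval M p) v))

  act-vzero : ∀ p → act p vzero ≡ vzero
  act-vzero p = mvec-vzero (peval M p)

  act-≋[] : ∀ {p} v → p ≋ [] → act p v ≡ vzero
  act-≋[] {[]}    v _      = act-[] v
  act-≋[] {a ∷ p} v a∷p≋[] rewrite coeff≡ a∷p≋[] zero = begin
    act (false ∷ p) v                       ≡⟨ act-∷ false p v ⟩
    vadd vzero (mvec M (act p v))           ≡⟨ vadd-identityˡ _ ⟩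
    mvec M (act p v)                        ≡⟨ cong (mvec M) (act-≋[] v (∷≋[]-tail a∷p≋[])) ⟩
    mvec M vzero                            ≡⟨ mvec-vzero M ⟩
    vzero                                   ∎
    where open ≡-Reasoning

  act-cong : ∀ {p q} v → p ≋ q → act p v ≡ act q v
  act-cong {[]}    {q}     v p≋q = trans (act-[] v) (sym (act-≋[] v (≋-sym p≋q)))
  act-cong {a ∷ p} {[]}    v p≋q = trans (act-≋[] v p≋q) (sym (act-[] v))
  act-cong {a ∷ p} {b ∷ q} v p≋q = begin
    act (a ∷ p) v
      ≡⟨ act-∷ a p v ⟩
    vadd (vscale a v) (mvec M (act p v))
      ≡⟨ cong₂ (λ c w → vadd (vscale c v) (mvec M w)) (coeff≡ p≋q zero) (act-cong v (∷-tail p≋q)) ⟩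
    vadd (vscale b v) (mvec M (act q v))
      ≡⟨ act-∷ b q v ⟨
    act (b ∷ q) v
      ∎
    where open ≡-Reasoning

  act-padd : ∀ p q v → act (padd p q) v ≡ vadd (act p v) (act q v)
  act-padd []      q       v = trans (sym (vadd-identityˡ _)) (cong (λ w → vadd w (act q v)) (sym (act-[] v)))
  act-padd (a ∷ p) []      v = trans (sym (vadd-identityʳ _)) (cong (vadd (act (a ∷ p) v)) (sym (act-[] v)))
  act-padd (a ∷ p) (b ∷ q) v = begin
    act (padd (a ∷ p) (b ∷ q)) v
      ≡⟨ act-∷ (a xor b) (padd p q) v ⟩
    vadd (vscale (a xor b) v) (mvec M (act (padd p q) v))
      ≡⟨ cong₂ vadd (vscale-xor a b v) (trans (cong (mvec M) (act-padd p q v)) (mvec-vadd M _ _)) ⟩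
    vadd (vadd (vscale a v) (vscale b v)) (vadd (mvec M (act p v)) (mvec M (act q v)))
      ≡⟨ vadd-interchange (vscale a v) (vscale b v) (mvec M (act p v)) (mvec M (act q v)) ⟩
    vadd (vadd (vscale a v) (mvec M (act p v))) (vadd (vscale b v) (mvec M (act q v)))
      ≡⟨ cong₂ vadd (act-∷ a p v) (act-∷ b q v) ⟨
    vadd (act (a ∷ p) v) (act (b ∷ q) v)
      ∎
    where open ≡-Reasoning

  mvec-act : ∀ p v → mvec M (act p v) ≡ act p (mvec M v)
  mvec-act []      v = trans (cong (mvec M) (act-[] v)) (trans (mvec-vzero M) (sym (act-[] (mvec M v))))
  mvec-act (a ∷ p) v = begin
    mvec M (act (a ∷ p) v)                                  ≡⟨ cong (mvec M) (act-∷ a p v) ⟩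
    mvec M (vadd (vscale a v) (mvec M (act p v)))           ≡⟨ mvec-vadd M _ _ ⟩
    vadd (mvec M (vscale a v)) (mvec M (mvec M (act p v)))  ≡⟨ cong₂ vadd (mvec-vscale M a v) (cong (mvec M) (mvec-act p v)) ⟩
    vadd (vscale a (mvec M v)) (mvec M (act p (mvec M v)))  ≡⟨ act-∷ a p (mvec M v) ⟨
    act (a ∷ p) (mvec M v)                                  ∎
    where open ≡-Reasoning

  act-pscale : ∀ a q v → act (pscale a q) v ≡ vscale a (act q v)
  act-pscale true  q v = act-cong v (pscale-true q)
  act-pscale false q v = act-≋[] v (pscale-false q)

  act-pmul : ∀ p q v → act (pmul p q) v ≡ act p (act q v)
  act-pmul []      q v = trans (act-[] v) (sym (act-[] _))
  act-pmul (a ∷ p) q v = begin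
    act (padd (pscale a q) (false ∷ pmul p q)) v
      ≡⟨ act-padd (pscale a q) (false ∷ pmul p q) v ⟩
    vadd (act (pscale a q) v) (act (false ∷ pmul p q) v)
      ≡⟨ cong₂ vadd (act-pscale a q v) (trans (act-∷ false (pmul p q) v) (vadd-identityˡ _)) ⟩
    vadd (vscale a (act q v)) (mvec M (act (pmul p q) v))
      ≡⟨ cong (λ w → vadd (vscale a (act q v)) (mvec M w)) (act-pmul p q v) ⟩
    vadd (vscale a (act q v)) (mvec M (act p (act q v)))
      ≡⟨ act-∷ a p (act q v) ⟨
    act (a ∷ p) (act q v)
      ∎
    where open ≡-Reasoning

  act-xMinus1 : ∀ v → act xMinus1 v ≡ vadd v (mvec M v)
  act-xMinus1 v = begin
    act (true ∷ true ∷ []) v                 ≡⟨ act-∷ true (true ∷ []) v ⟩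
    vadd v (mvec M (act (true ∷ []) v))      ≡⟨ cong (λ w → vadd v (mvec M w)) (trans (act-∷ true [] v) (cong (vadd v) lower)) ⟩
    vadd v (mvec M (vadd v vzero))           ≡⟨ cong (λ w → vadd v (mvec M w)) (vadd-identityʳ v) ⟩
    vadd v (mvec M v)                        ∎
    where
    open ≡-Reasoning
    lower : mvec M (act [] v) ≡ vzero
    lower = trans (cong (mvec M) (act-[] v)) (mvec-vzero M)

  orbitSum≡act-geom : ∀ v j → orbitSum M v j ≡ act (geom j) v
  orbitSum≡act-geom v zero    = sym (act-[] v)
  orbitSum≡act-geom v (suc j) = begin
    vadd (mvec M (orbitSum M v j)) v       ≡⟨ vadd-comm _ v ⟩
    vadd v (mvec M (orbitSum M v j))       ≡⟨ cong (λ w → vadd v (mvec M w)) (orbitSum≡act-geom v j) ⟩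
    vadd v (mvec M (act (geom j) v))       ≡⟨ act-∷ true (geom j) v ⟨
    act (geom (suc j)) v                   ∎
    where open ≡-Reasoning

  act-toList : ∀ {m} (c : Vec Bool m) v → act (toList c) v ≡ lincomb c (λ i → mvec (mpow M (toℕ i)) v)
  act-toList []      v = act-[] v
  act-toList (a ∷ c) v = begin
    act (a ∷ toList c) v
      ≡⟨ act-∷ a (toList c) v ⟩
    vadd (vscale a v) (mvec M (act (toList c) v))
      ≡⟨ cong₂ vadd (cong (vscale a) (sym (mvec-mid v))) (trans (mvec-act (toList c) v) (act-toList c (mvec M v))) ⟩
    vadd (vscale a (mvec mid v)) (lincomb c (λ i → mvec (mpow M (toℕ i)) (mvec M v)))
      ≡⟨ cong (vadd (vscale a (mvec mid v))) (lincomb-cong c λ i → sym (mvec-mmul (mpow M (toℕ i)) M v)) ⟩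
    lincomb (a ∷ c) (λ i → mvec (mpow M (toℕ i)) v)
      ∎
    where open ≡-Reasoning

  ∣≋⇒act≡vzero : ∀ {f p} → peval M f ≡ mzero → f ∣≋ p → ∀ v → act p v ≡ vzero
  ∣≋⇒act≡vzero {f} {p} f[M]≡0 (q , qf≋p) v = begin
    act p v              ≡⟨ act-cong v qf≋p ⟨
    act (pmul q f) v     ≡⟨ act-pmul q f v ⟩
    act q (act f v)      ≡⟨ cong (λ A → act q (mvec A v)) f[M]≡0 ⟩
    act q (mvec mzero v) ≡⟨ cong (act q) (mvec-mzero v) ⟩
    act q vzero          ≡⟨ act-vzero q ⟩
    vzero                ∎
    where open ≡-Reasoning

-- Division by a monic polynomial, and cyclic vectors

monic-decompose : ∀ n f → length f ≡ suc n → Monic f → ∃ λ (f₀ : Vec Bool n) → f ≡ toList f₀ ++ pone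
monic-decompose zero    (a ∷ [])    refl refl = [] , refl
monic-decompose (suc n) (a ∷ b ∷ f) len  lst  with monic-decompose n (b ∷ f) (cong Data.Nat.pred len) lst
... | f₀ , eq = a ∷ f₀ , cong (a ∷_) eq

toList-vadd : ∀ {m} (x y : Vec Bool m) → toList (vadd x y) ≡ padd (toList x) (toList y)
toList-vadd []      []      = refl
toList-vadd (a ∷ x) (b ∷ y) = cong ((a xor b) ∷_) (toList-vadd x y)

++-false≋ : ∀ L → L ++ (false ∷ []) ≋ L
++-false≋ []      = false∷≋[] ≋-refl
++-false≋ (a ∷ L) = ∷-cong refl (++-false≋ L)

replicate-false≋[] : ∀ m → List.replicate m false ≋ []
replicate-false≋[] zero    = ≋-refl
replicate-false≋[] (suc m) = false∷≋[] (replicate-false≋[] m)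

module Division {n} (f₀ : Vec Bool n) where

  f : Poly
  f = toList f₀ ++ pone

  toList-++ : ∀ (r : Vec Bool n) L → toList r ++ L ≡ padd (toList r) (shift n L)
  toList-++ r L = subst (λ m → toList r ++ L ≡ padd (toList r) (shift m L)) (length-toList r) (sym (padd-shift-length (toList r)))
    where
    padd-shift-length : ∀ K → padd K (shift (length K) L) ≡ K ++ L
    padd-shift-length []      = refl
    padd-shift-length (a ∷ K) = cong₂ _∷_ (xor-identityʳ a) (padd-shift-length K)

  xⁿ≋ : shift n pone ≋ padd f (toList f₀)
  xⁿ≋ = ≋-sym (begin
    padd f (toList f₀)                                  ≡⟨ cong (λ g → padd g (toList f₀)) (toList-++ f₀ pone) ⟩
    padd (padd (toList f₀) (shift n pone)) (toList f₀)  ≈⟨ Padd.xy∙z≈y∙xz (toList f₀) (shift n pone) (toList f₀) ⟩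
    padd (shift n pone) (padd (toList f₀) (toList f₀))  ≈⟨ padd-congʳ (shift n pone) (padd-self (toList f₀)) ⟩
    padd (shift n pone) []                              ≈⟨ padd-identityʳ _ ⟩
    shift n pone                                        ∎)
    where open ≋-Reasoning

  reduce-top : ∀ q (r : Vec Bool n) top →
               ∃₂ λ q' (r' : Vec Bool n) → padd (pmul q f) (toList r ++ (top ∷ [])) ≋ padd (pmul q' f) (toList r')
  reduce-top q r false = q , r , padd-congʳ (pmul q f) (++-false≋ (toList r))
  reduce-top q r true  = padd q pone , vadd r f₀ , (begin
    padd (pmul q f) (toList r ++ pone)
      ≡⟨ cong (padd (pmul q f)) (toList-++ r pone) ⟩
    padd (pmul q f) (padd (toList r) (shift n pone))
      ≈⟨ padd-congʳ (pmul q f) (padd-congʳ (toList r) xⁿ≋) ⟩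
    padd (pmul q f) (padd (toList r) (padd f (toList f₀)))
      ≈⟨ padd-congʳ (pmul q f) (Padd.x∙yz≈y∙xz (toList r) f (toList f₀)) ⟩
    padd (pmul q f) (padd f (padd (toList r) (toList f₀)))
      ≈⟨ padd-assoc (pmul q f) f _ ⟨
    padd (padd (pmul q f) f) (padd (toList r) (toList f₀))
      ≈⟨ padd-cong (≋-trans (padd-congʳ (pmul q f) (≋-sym (pmul-identityˡ f))) (≋-sym (pmul-distribʳ q pone f)))
                   (≡⇒≋ (sym (toList-vadd r f₀))) ⟩
    padd (pmul (padd q pone) f) (toList (vadd r f₀))
      ∎)
    where open ≋-Reasoning

  divMod : ∀ p → ∃₂ λ q (r : Vec Bool n) → p ≋ padd (pmul q f) (toList r)
  divMod []      = [] , Vec.replicate n false , ≋-sym (≋-trans (≡⇒≋ (toList-replicate n false)) (replicate-false≋[] n))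
  divMod (a ∷ p) with divMod p
  ... | q , r , p≋qf+r with initLast (a ∷ r)
  ... | r' , top , a∷r≡r'∷ʳtop with reduce-top (false ∷ q) r' top
  ... | q' , r'' , reduced = q' , r'' , (begin
    a ∷ p                                                   ≈⟨ ∷-cong refl p≋qf+r ⟩
    padd (false ∷ pmul q f) (a ∷ toList r)                  ≈⟨ padd-congˡ (a ∷ toList r) (≋-sym (pmul-false∷ q f)) ⟩
    padd (pmul (false ∷ q) f) (toList (a ∷ r))              ≡⟨ cong (λ v → padd (pmul (false ∷ q) f) (toList v)) a∷r≡r'∷ʳtop ⟩
    padd (pmul (false ∷ q) f) (toList (r' ∷ʳ top))          ≡⟨ cong (padd (pmul (false ∷ q) f)) (toList-∷ʳ top r') ⟩
    padd (pmul (false ∷ q) f) (toList r' ++ (top ∷ []))     ≈⟨ reduced ⟩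
    padd (pmul q' f) (toList r'')                           ∎)
    where open ≋-Reasoning

amul-asMat-asTrans : ∀ {n} (M : Mat n) v → amul (asMat M) (asTrans v) ≡ (M , v)
amul-asMat-asTrans M v = cong₂ _,_ (mmul-identityʳ M) (trans (cong (λ w → vadd w v) (mvec-mid vzero)) (vadd-identityˡ v))

module CyclicVector {n} (M : Mat n) (t : Vec₂ n) (f₀ : Vec Bool n)
  (f[M]≡0 : peval M (toList f₀ ++ pone) ≡ mzero)
  (independent : ∀ c → lincomb c (λ (i : Fin n) → mvec (mpow M (toℕ i)) t) ≡ vzero → c ≡ Vec.replicate n false)
  where

  open PolyAction M
  open Division f₀

  act≡vzero⇒∣≋ : ∀ {p} → act p t ≡ vzero → f ∣≋ p
  act≡vzero⇒∣≋ {p} p[M]t≡0 with divMod p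
  ... | q , r , p≋qf+r = q , ≋-sym (≋-trans p≋qf+r (≋-trans (padd-congʳ (pmul q f) r≋[]) (padd-identityʳ _)))
    where
    open ≡-Reasoning
    combination≡0 : lincomb r (λ i → mvec (mpow M (toℕ i)) t) ≡ vzero
    combination≡0 = begin
      lincomb r (λ i → mvec (mpow M (toℕ i)) t)      ≡⟨ act-toList r t ⟨
      act (toList r) t                               ≡⟨ vadd-identityˡ _ ⟨
      vadd vzero (act (toList r) t)                  ≡⟨ cong (λ w → vadd w (act (toList r) t)) (∣≋⇒act≡vzero f[M]≡0 (q , ≋-refl) t) ⟨
      vadd (act (pmul q f) t) (act (toList r) t)     ≡⟨ act-padd (pmul q f) (toList r) t ⟨
      act (padd (pmul q f) (toList r)) t             ≡⟨ act-cong t p≋qf+r ⟨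
      act p t                                        ≡⟨ p[M]t≡0 ⟩
      vzero                                          ∎
    r≋[] : toList r ≋ []
    r≋[] = subst (λ c → toList c ≋ []) (sym (independent r combination≡0))
                 (≋-trans (≡⇒≋ (toList-replicate n false)) (replicate-false≋[] n))

  module _ {α : ℕ} (e : ℕ) (H : Poly) (M-order : HasOrder mid (mpow M) α)
           (geom-factor : pmul (geom α) xMinus1 ≋ pmul H (ppow xMinus1 (suc e))) where

    private
      w = orbitSum M t α
      g = amul (asMat M) (asTrans t)

      w≡act-geom : w ≡ act (geom α) t
      w≡act-geom = orbitSum≡act-geom t α

    f∣HXᵉ⁺¹ : f ∣≋ pmul H (ppow xMinus1 (suc e))
    f∣HXᵉ⁺¹ = ∣≋-respʳ (act≡vzero⇒∣≋ (begin
      act (pmul (geom α) xMinus1) t        ≡⟨ act-cong t (pmul-comm (geom α) xMinus1) ⟩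
      act (pmul xMinus1 (geom α)) t        ≡⟨ act-pmul xMinus1 (geom α) t ⟩
      act xMinus1 (act (geom α) t)         ≡⟨ cong (act xMinus1) w≡act-geom ⟨
      act xMinus1 w                        ≡⟨ act-xMinus1 w ⟩
      vadd w (mvec M w)                    ≡⟨ cong (vadd w) (orbitSum-fixed M t α (proj₁ (proj₂ M-order))) ⟩
      vadd w w                             ≡⟨ vadd-self w ⟩
      vzero                                ∎)) geom-factor
      where open ≡-Reasoning

    geom≋HXᵉ : geom α ≋ pmul H (ppow xMinus1 e)
    geom≋HXᵉ = pmul-cancelʳ-xMinus1 (≋-trans geom-factor (pmul-xMinus1^-suc H e))

    hasOrder-α : ¬ ppow xMinus1 (suc e) ∣≋ f → HasOrder aone (apow g) α
    hasOrder-α Xᵉ⁺¹∤f = subst (λ h → HasOrder aone (apow h) α) (sym (amul-asMat-asTrans M t))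
      (orbitSum≡vzero⇒hasOrder M t M-order (trans w≡act-geom
        (∣≋⇒act≡vzero f[M]≡0 (∣≋-respʳ (∣≋-reduce-xMinus1^ e {g = H} Xᵉ⁺¹∤f f∣HXᵉ⁺¹) (≋-sym geom≋HXᵉ)) t)))

    hasOrder-2α : eval1 H ≡ true → ppow xMinus1 (suc e) ∣≋ f → HasOrder aone (apow g) (2 * α)
    hasOrder-2α H₁≡1 Xᵉ⁺¹∣f = subst (λ h → HasOrder aone (apow h) (2 * α)) (sym (amul-asMat-asTrans M t))
      (orbitSum≢vzero⇒hasOrder-double M t M-order λ w≡0 →
        xMinus1^∣⇒∤ e {H = H} H₁≡1 Xᵉ⁺¹∣f (∣≋-respʳ (act≡vzero⇒∣≋ (trans (sym w≡act-geom) w≡0)) geom≋HXᵉ))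

lemma7p2 : (n : ℕ) (σ : Mat n) (t : Vec₂ n) (f : Poly) (α k m : ℕ)
    → IsInvertible σ
    → IsMinPoly σ f
    → length f ≡ suc n
    → IsBasis (λ (i : Fin n) → mvec (mpow σ (toℕ i)) t)
    → HasOrder mid (mpow σ) α
    → α ≡ k * 2 ^ m
    → ¬ (2 ∣ k)
    → (¬ (ppow xMinus1 (2 ^ m) ∣ₚ f)
         → HasOrder aone (apow (amul (asMat σ) (asTrans t))) α)
      × (xMinus1 ^ (2 ^ m) ∥ₚ f
         → HasOrder aone (apow (amul (asMat σ) (asTrans t))) (2 * α))
lemma7p2 n σ t f α k m _ (f-monic , f[σ]≡0 , _) deg-f (independent , _) σ-order refl k-odd
  with monic-decompose n f deg-f f-monic | geom-odd*2^m-factor k-odd m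
... | f₀ , refl | H , H₁≡1 , factor =
  (λ X²ᵐ∤f → hasOrder-α e H σ-order geom-factor (X²ᵐ∤f ∘ ∣≋⇒∣ₚ ∘ X^-∣≋-f (sym 2^m≡1+e))) ,
  (λ (X²ᵐ∣f , _) → hasOrder-2α e H σ-order geom-factor H₁≡1 (X^-∣≋-f 2^m≡1+e (∣ₚ⇒∣≋ X²ᵐ∣f)))
  where
  open CyclicVector σ t f₀ f[σ]≡0 independent
  e : ℕ
  e = pred (2 ^ m)
  2^m≡1+e : 2 ^ m ≡ suc e
  2^m≡1+e = sym (suc-pred (2 ^ m) {{m^n≢0 2 m}})
  geom-factor : pmul (geom (k * 2 ^ m)) xMinus1 ≋ pmul H (ppow xMinus1 (suc e))
  geom-factor = subst (λ a → pmul (geom (k * 2 ^ m)) xMinus1 ≋ pmul H (ppow xMinus1 a)) 2^m≡1+e factor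
  X^-∣≋-f : ∀ {a b} → a ≡ b → ppow xMinus1 a ∣≋ toList f₀ ++ pone → ppow xMinus1 b ∣≋ toList f₀ ++ pone
  X^-∣≋-f = subst (λ a → ppow xMinus1 a ∣≋ toList f₀ ++ pone)
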